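{- For any Baxter permutation $\pi$ of $[n]$, the three lattice paths in $\Gamma'(\pi)$ are pairwise non-intersecting.
   Context: A permutation $\pi=\pi_1\cdots\pi_n$ of $[n]$ is Baxter if there are no indices $1\le i<j<j+1<k\le n$ with $\pi_{j+1}<\pi_i<\pi_k<\pi_j$ or $\pi_j<\pi_k<\pi_i<\pi_{j+1}$. For a permutation $\pi$ of $[n]$ let $\mathrm{DB}(\pi)=\{\pi_{i+1}:\pi_i>\pi_{i+1}\}$, $\widetilde{\mathrm{DT}}(\pi)=\{\pi_i-1:\pi_i>\pi_{i+1}\}$, and $\mathrm{IDES}(\pi)=\{i\in[n-1]:\pi^{ -1}_i>\pi^{ -1}_{i+1}\}$ (the set of $i$ such that $i+1$ appears before $i$ in $\pi$). Lattice paths use unit steps $(1,0)$ (horizontal) and $(0,1)$ (vertical); a path with $m$ steps encodes $S\subseteq[m]$ if its $i$-th step is horizontal iff $i\in S$. $\Gamma'(\pi)$ is the triple of lattice paths with $n-1$ steps each: the bottom one starting at $(2,0)$ encoding $\mathrm{DB}(\pi)$, the middle one starting at $(1,1)$ encoding $\mathrm{IDES}(\pi)$, and the top one starting at $(0,2)$ encoding $\widetilde{\mathrm{DT}}(\pi)$. Non-intersecting means no two of the paths share a vertex. -}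

module Defs where

open import Data.Nat using (ℕ; zero; suc; _+_; _∸_; _<_; _≤_)
open import Data.Fin using (Fin; toℕ)
open import Data.Product using (Σ; _×_; _,_)
open import Relation.Binary.PropositionalEquality using (_≡_)
open import Relation.Nullary using (¬_)
open import Function.Definitions using (Bijective)

-- A permutation of [n]: a bijection on Fin n.  Position p ∈ Fin n stands for
-- the 1-based index toℕ p + 1, and the entry there is val π p = toℕ (π p) + 1.
record Perm (n : ℕ) : Set where
  field
    fun : Fin n → Fin n
    bij : Bijective _≡_ _≡_ fun
open Perm public

val : ∀ {n} → Perm n → Fin n → ℕ
val π p = suc (toℕ (fun π p))

Next : ∀ {n} → Fin n → Fin n → Set
Next p q = toℕ q ≡ suc (toℕ p)

IsBaxter : ∀ {n} → Perm n → Set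
IsBaxter {n} π =
  (i j j' k : Fin n) → toℕ i < toℕ j → Next j j' → toℕ j' < toℕ k →
    ¬ ((val π j' < val π i × val π i < val π k × val π k < val π j)
      ⊎' (val π j < val π k × val π k < val π i × val π i < val π j'))
  where
  open import Data.Sum renaming (_⊎_ to _⊎'_)

DB : ∀ {n} → Perm n → ℕ → Set
DB {n} π m = Σ (Fin n) λ p → Σ (Fin n) λ q →
  Next p q × val π q < val π p × m ≡ val π q

DTt : ∀ {n} → Perm n → ℕ → Set
DTt {n} π m = Σ (Fin n) λ p → Σ (Fin n) λ q →
  Next p q × val π q < val π p × m ≡ val π p ∸ 1

IDES : ∀ {n} → Perm n → ℕ → Set
IDES {n} π m = 1 ≤ m × m ≤ n ∸ 1 × Σ (Fin n) λ a → Σ (Fin n) λ b →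
  val π a ≡ m × val π b ≡ suc m × toℕ b < toℕ a

Point : Set
Point = ℕ × ℕ

-- w is (the vertex sequence of) the lattice path with m steps starting at s
-- encoding S ⊆ [m]: w 0 = s, and step t (1 ≤ t ≤ m) is horizontal iff t ∈ S.
-- Vertices of the path are w t for t ≤ m.
IsPath : ℕ → Point → (ℕ → Set) → (ℕ → Point) → Set
IsPath m (x , y) S w =
  w 0 ≡ (x , y) ×
  ((t : ℕ) → t < m →
     (S (suc t) → w (suc t) ≡ (Data.Product.proj₁ (w t) + 1 , Data.Product.proj₂ (w t)))
   × (¬ S (suc t) → w (suc t) ≡ (Data.Product.proj₁ (w t) , Data.Product.proj₂ (w t) + 1)))
  where import Data.Product

Disjoint : ℕ → (ℕ → Point) → (ℕ → Point) → Set
Disjoint m w v = (s t : ℕ) → s ≤ m → t ≤ m → ¬ (w s ≡ v t)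

-- All three paths start on the antidiagonal x + y = 2 and move one antidiagonal
-- per step, so they are disjoint once, after every t steps, the bottom path lies
-- strictly right of the middle one and the middle one strictly right of the top
-- one.  The x-coordinate after t steps counts the elements of the encoded set in
-- [1, t], so it suffices to have injections DT~ → IDES → DB that never increase
-- their argument.
--   * For m ∈ IDES, m + 1 stands before m; some descent between them drops to a
--     value π_{q} ≤ m, and that bottom lies in DB.  Two such m < m' sharing a
--     descent would form a 2-41-3 pattern.
--   * For a descent π_p > π_{p+1}, the values in [π_{p+1}, π_p] go from "not at
--     a position ≤ p" to "at a position ≤ p"; the switch is some i ∈ IDES with
--     i ≤ π_p − 1.  Two descents p < p' sharing i would force an ascent between
--     them that, with the positions of i + 1 and i, forms a 3-14-2 pattern.
module Submission where

open import Defs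
open import Data.Nat using (ℕ; zero; suc; _+_; _∸_; _<_; _≤_; z≤n; s≤s; _≟_; _≤?_; _<?_)
open import Data.Nat.Properties
open import Data.Fin using (Fin; toℕ; fromℕ<)
import Data.Fin.Properties as Fin
open import Data.Product using (Σ; ∃; _×_; _,_; proj₁; proj₂)
open import Data.Sum using (inj₁; inj₂)
open import Data.Empty using (⊥)
open import Function using (_∘_)
open import Relation.Binary.Definitions using (tri<; tri≈; tri>)
open import Relation.Binary.PropositionalEquality
  using (_≡_; _≢_; refl; sym; trans; cong; subst; subst₂; module ≡-Reasoning)
open import Relation.Nullary using (¬_; Dec; yes; no; contradiction)
open import Relation.Nullary.Decidable using (_×-dec_; ¬?)
open import Relation.Unary using (Decidable)

<⇒≤∸1 : ∀ {m n} → m < n → m ≤ n ∸ 1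
<⇒≤∸1 {n = suc n} (s≤s m≤n) = m≤n

count : {P : ℕ → Set} → Decidable P → ℕ → ℕ
count P? zero    = 0
count P? (suc t) with P? (suc t)
... | yes _ = suc (count P? t)
... | no _  = count P? t

count-≤-suc : ∀ {P : ℕ → Set} (P? : Decidable P) t → count P? t ≤ count P? (suc t)
count-≤-suc P? t with P? (suc t)
... | yes _ = n≤1+n _
... | no _  = ≤-refl

remove : ∀ {Q : ℕ → Set} → Decidable Q → (k : ℕ) → Decidable (λ m → Q m × m ≢ k)
remove Q? k m = Q? m ×-dec ¬? (m ≟ k)

count-remove-beyond : ∀ {Q : ℕ → Set} (Q? : Decidable Q) {k} t → t < k → count (remove Q? k) t ≡ count Q? t
count-remove-beyond Q? zero    _   = refl
count-remove-beyond Q? {k} (suc t) t<k with Q? (suc t) | suc t ≟ k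
... | yes _ | no _    = cong suc (count-remove-beyond Q? t (<-trans (n<1+n t) t<k))
... | no _  | _       = count-remove-beyond Q? t (<-trans (n<1+n t) t<k)
... | yes _ | yes t≡k = contradiction t≡k (<⇒≢ t<k)

count-remove : ∀ {Q : ℕ → Set} (Q? : Decidable Q) {k} t → Q k → 1 ≤ k → k ≤ t →
  suc (count (remove Q? k) t) ≡ count Q? t
count-remove Q? zero qk () z≤n
count-remove Q? {k} (suc t) qk 1≤k k≤1+t with k ≟ suc t
... | yes refl with Q? (suc t) | suc t ≟ suc t
...   | yes _ | yes _ = cong suc (count-remove-beyond Q? t ≤-refl)
...   | no ¬q | _     = contradiction qk ¬q
...   | yes _ | no ne = contradiction refl ne
count-remove Q? {k} (suc t) qk 1≤k k≤1+t | no k≢1+t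
  with Q? (suc t) | suc t ≟ k | count-remove Q? t qk 1≤k (≤-pred (≤∧≢⇒< k≤1+t k≢1+t))
... | yes _ | no _  | ih = cong suc ih
... | no _  | _     | ih = ih
... | yes _ | yes e | _  = contradiction (sym e) k≢1+t

record DecreasingInjection (P Q : ℕ → Set) (t : ℕ) : Set where
  field
    f           : ∀ {m} → P m → ℕ
    f-pos       : ∀ {m} (x : P m) → m ≤ t → 1 ≤ f x
    f-≤         : ∀ {m} (x : P m) → m ≤ t → f x ≤ m
    f-into      : ∀ {m} (x : P m) → m ≤ t → Q (f x)
    f-injective : ∀ {m m'} (x : P m) (y : P m') → m ≤ t → m' ≤ t → f x ≡ f y → m ≡ m'

module _ {P Q : ℕ → Set} {t : ℕ} (ι : DecreasingInjection P Q (suc t)) where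
  open DecreasingInjection ι

  restrict : DecreasingInjection P Q t
  restrict = record
    { f           = f
    ; f-pos       = λ x m≤t → f-pos x (m≤n⇒m≤1+n m≤t)
    ; f-≤         = λ x m≤t → f-≤ x (m≤n⇒m≤1+n m≤t)
    ; f-into      = λ x m≤t → f-into x (m≤n⇒m≤1+n m≤t)
    ; f-injective = λ x y m≤t m'≤t → f-injective x y (m≤n⇒m≤1+n m≤t) (m≤n⇒m≤1+n m'≤t)
    }

  restrict-avoiding : (top : P (suc t)) → DecreasingInjection P (λ k → Q k × k ≢ f top) t
  restrict-avoiding top = record
    { f           = f
    ; f-pos       = f-pos′
    ; f-≤         = f-≤′
    ; f-into      = λ x m≤t → f-into′ x m≤t , λ e → <⇒≢ (s≤s m≤t) (f-injective x top (m≤n⇒m≤1+n m≤t) ≤-refl e)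
    ; f-injective = f-injective′
    }
    where
    open DecreasingInjection restrict using ()
      renaming (f-pos to f-pos′; f-≤ to f-≤′; f-into to f-into′; f-injective to f-injective′)

count-mono : ∀ {P Q : ℕ → Set} (P? : Decidable P) (Q? : Decidable Q) t →
  DecreasingInjection P Q t → count P? t ≤ count Q? t
count-mono P? Q? zero    ι = z≤n
count-mono {Q = Q} P? Q? (suc t) ι with P? (suc t)
... | no _    = ≤-trans (count-mono P? Q? t (restrict ι)) (count-≤-suc Q? t)
... | yes top = begin
  suc (count P? t)                    ≤⟨ s≤s (count-mono P? Q?∖k t (restrict-avoiding ι top)) ⟩
  suc (count Q?∖k t)                  ≤⟨ s≤s (count-≤-suc Q?∖k t) ⟩
  suc (count Q?∖k (suc t))            ≡⟨ count-remove Q? (suc t) (f-into top ≤-refl) (f-pos top ≤-refl) (f-≤ top ≤-refl) ⟩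
  count Q? (suc t)                    ∎
  where
  open DecreasingInjection ι
  open ≤-Reasoning
  Q?∖k : Decidable (λ k → Q k × k ≢ f top)
  Q?∖k = remove Q? (f top)

module _ {m x y : ℕ} {S : ℕ → Set} {w : ℕ → Point} (S? : Decidable S) (path : IsPath m (x , y) S w) where
  open ≡-Reasoning

  path-x : ∀ {t} → t ≤ m → proj₁ (w t) ≡ x + count S? t
  path-x {zero} _ = trans (cong proj₁ (proj₁ path)) (sym (+-identityʳ x))
  path-x {suc t} t<m with S? (suc t) | proj₂ path t t<m
  ... | yes s | (horizontal , _) = begin
    proj₁ (w (suc t))       ≡⟨ cong proj₁ (horizontal s) ⟩
    proj₁ (w t) + 1         ≡⟨ cong (_+ 1) (path-x (<⇒≤ t<m)) ⟩
    x + count S? t + 1      ≡⟨ +-comm _ 1 ⟩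
    suc (x + count S? t)    ≡⟨ sym (+-suc x _) ⟩
    x + suc (count S? t)    ∎
  ... | no ¬s | (_ , vertical) = trans (cong proj₁ (vertical ¬s)) (path-x (<⇒≤ t<m))

  path-level : ∀ {t} → t ≤ m → proj₁ (w t) + proj₂ (w t) ≡ x + y + t
  path-level {zero} _ = trans (cong (λ (a , b) → a + b) (proj₁ path)) (sym (+-identityʳ (x + y)))
  path-level {suc t} t<m with S? (suc t) | proj₂ path t t<m
  ... | yes s | (horizontal , _) = begin
    proj₁ (w (suc t)) + proj₂ (w (suc t))  ≡⟨ cong (λ (a , b) → a + b) (horizontal s) ⟩
    proj₁ (w t) + 1 + proj₂ (w t)          ≡⟨ cong (_+ proj₂ (w t)) (+-comm _ 1) ⟩
    suc (proj₁ (w t) + proj₂ (w t))        ≡⟨ cong suc (path-level (<⇒≤ t<m)) ⟩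
    suc (x + y + t)                        ≡⟨ sym (+-suc (x + y) t) ⟩
    x + y + suc t                          ∎
  ... | no ¬s | (_ , vertical) = begin
    proj₁ (w (suc t)) + proj₂ (w (suc t))  ≡⟨ cong (λ (a , b) → a + b) (vertical ¬s) ⟩
    proj₁ (w t) + (proj₂ (w t) + 1)        ≡⟨ cong (proj₁ (w t) +_) (+-comm _ 1) ⟩
    proj₁ (w t) + suc (proj₂ (w t))        ≡⟨ +-suc _ _ ⟩
    suc (proj₁ (w t) + proj₂ (w t))        ≡⟨ cong suc (path-level (<⇒≤ t<m)) ⟩
    suc (x + y + t)                        ≡⟨ sym (+-suc (x + y) t) ⟩
    x + y + suc t                          ∎

disjoint-if-strictly-right : ∀ {m x y x' y' S S' w v} (S? : Decidable S) (S'? : Decidable S') →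
  IsPath m (x , y) S w → IsPath m (x' , y') S' v → x + y ≡ x' + y' →
  (∀ t → t ≤ m → x' + count S'? t < x + count S? t) → Disjoint m w v
disjoint-if-strictly-right {x = x} {y} {x'} {y'} {w = w} {v} S? S'? w-path v-path same-diagonal right
  s t s≤m t≤m ws≡vt =
  <⇒≢ (right s s≤m) (sym same-x)
  where
  open ≡-Reasoning
  s≡t : s ≡ t
  s≡t = +-cancelˡ-≡ (x + y) s t (begin
    x + y + s                      ≡⟨ sym (path-level S? w-path s≤m) ⟩
    proj₁ (w s) + proj₂ (w s)      ≡⟨ cong (λ (a , b) → a + b) ws≡vt ⟩
    proj₁ (v t) + proj₂ (v t)      ≡⟨ path-level S'? v-path t≤m ⟩
    x' + y' + t                    ≡⟨ cong (_+ t) (sym same-diagonal) ⟩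
    x + y + t                      ∎)
  same-x : x + count S? s ≡ x' + count S'? s
  same-x = begin
    x + count S? s                 ≡⟨ sym (path-x S? w-path s≤m) ⟩
    proj₁ (w s)                    ≡⟨ cong proj₁ ws≡vt ⟩
    proj₁ (v t)                    ≡⟨ path-x S'? v-path t≤m ⟩
    x' + count S'? t               ≡⟨ cong (λ u → x' + count S'? u) (sym s≡t) ⟩
    x' + count S'? s               ∎

discrete-ivt : ∀ {G : ℕ → Set} → Decidable G → ∀ {s e} → s ≤ e → ¬ G s → G e →
  ∃ λ j → s ≤ j × j < e × ¬ G j × G (suc j)
discrete-ivt G? {e = zero}  z≤n     ¬gs ge = contradiction ge ¬gs
discrete-ivt {G} G? {s} {suc e} s≤1+e ¬gs ge = from (G? e)
  where
  s≤e : s ≤ e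
  s≤e = ≤-pred (≤∧≢⇒< s≤1+e λ { refl → ¬gs ge })
  from : Dec (G e) → ∃ λ j → s ≤ j × j < suc e × ¬ G j × G (suc j)
  from (yes ge′) with discrete-ivt G? s≤e ¬gs ge′
  ... | j , s≤j , j<e , ¬gj , gj+1 = j , s≤j , m<n⇒m<1+n j<e , ¬gj , gj+1
  from (no ¬ge′) = e , s≤e , ≤-refl , ¬ge′ , ge

module _ {n : ℕ} where

  next⇒< : ∀ {p q : Fin n} → Next p q → toℕ p < toℕ q
  next⇒< next = ≤-reflexive (sym next)

  next-injective : ∀ {p p' q : Fin n} → Next p q → Next p' q → p ≡ p'
  next-injective next next' = Fin.toℕ-injective (suc-injective (trans (sym next) next'))

  record Crossing (U : Fin n → Set) (lo hi : Fin n) : Set where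
    field
      p q  : Fin n
      next : Next p q
      lo≤p : toℕ lo ≤ toℕ p
      q≤hi : toℕ q ≤ toℕ hi
      ¬U-p : ¬ U p
      U-q  : U q

  crossing : ∀ {U : Fin n → Set} → Decidable U → ∀ {lo hi} → toℕ lo ≤ toℕ hi → ¬ U lo → U hi → Crossing U lo hi
  crossing {U} U? {lo} {hi} lo≤hi ¬U-lo U-hi with discrete-ivt UAt? lo≤hi ¬UAt-lo (hi , refl , U-hi)
    where
    UAt : ℕ → Set
    UAt k = Σ (Fin n) λ x → toℕ x ≡ k × U x
    UAt? : Decidable UAt
    UAt? k = Fin.any? λ x → (toℕ x ≟ k) ×-dec U? x
    ¬UAt-lo : ¬ UAt (toℕ lo)
    ¬UAt-lo (x , x≡lo , U-x) = ¬U-lo (subst U (Fin.toℕ-injective x≡lo) U-x)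
  ... | j , lo≤j , j<hi , ¬UAt-j , (q , q≡1+j , U-q) = record
    { p    = p
    ; q    = q
    ; next = trans q≡1+j (cong suc (sym p≡j))
    ; lo≤p = subst (toℕ lo ≤_) (sym p≡j) lo≤j
    ; q≤hi = subst (_≤ toℕ hi) (sym q≡1+j) j<hi
    ; ¬U-p = λ U-p → ¬UAt-j (p , p≡j , U-p)
    ; U-q  = U-q
    }
    where
    j<n : j < n
    j<n = <-trans j<hi (Fin.toℕ<n hi)
    p : Fin n
    p = fromℕ< j<n
    p≡j : toℕ p ≡ j
    p≡j = Fin.toℕ-fromℕ< j<n

module _ {n : ℕ} (π : Perm n) where

  val-injective : ∀ {x y} → val π x ≡ val π y → x ≡ y
  val-injective = proj₁ (bij π) ∘ Fin.toℕ-injective ∘ suc-injective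

  val≤n : ∀ x → val π x ≤ n
  val≤n x = Fin.toℕ<n (fun π x)

  val-surjective : ∀ {v} → 1 ≤ v → v ≤ n → ∃ λ x → val π x ≡ v
  val-surjective {suc u} _ u<n with proj₂ (bij π) (fromℕ< u<n)
  ... | x , πx≡u = x , cong suc (trans (cong toℕ (πx≡u refl)) (Fin.toℕ-fromℕ< u<n))

  val≢⇒toℕ≢ : ∀ {x y} → val π x ≢ val π y → toℕ x ≢ toℕ y
  val≢⇒toℕ≢ ≢ = ≢ ∘ cong (val π) ∘ Fin.toℕ-injective

  val≤∧≢⇒< : ∀ {x y} → val π x ≤ val π y → x ≢ y → val π x < val π y
  val≤∧≢⇒< le ≢ = ≤∧≢⇒< le (≢ ∘ val-injective)

  DB? : Decidable (DB π)
  DB? m = Fin.any? λ p → Fin.any? λ q →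
    (toℕ q ≟ suc (toℕ p)) ×-dec (val π q <? val π p) ×-dec (m ≟ val π q)

  DTt? : Decidable (DTt π)
  DTt? m = Fin.any? λ p → Fin.any? λ q →
    (toℕ q ≟ suc (toℕ p)) ×-dec (val π q <? val π p) ×-dec (m ≟ val π p ∸ 1)

  IDES? : Decidable (IDES π)
  IDES? m = (1 ≤? m) ×-dec (m ≤? n ∸ 1) ×-dec (Fin.any? λ a → Fin.any? λ b →
    (val π a ≟ m) ×-dec (val π b ≟ suc m) ×-dec (suc (toℕ b) ≤? toℕ a))

  Below : ℕ → Fin n → Set
  Below m x = val π x ≤ m

  descent-below : ∀ {m a b} → val π a ≡ m → val π b ≡ suc m → toℕ b < toℕ a → Crossing (Below m) b a
  descent-below {m} va vb b<a =
    crossing (λ x → val π x ≤? m) (<⇒≤ b<a) (λ vb≤m → 1+n≰n (subst (_≤ m) vb vb≤m)) (≤-reflexive va)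

  descent-below-DB : ∀ {m b a} (c : Crossing (Below m) b a) → DB π (val π (Crossing.q c))
  descent-below-DB c = p , q , next , ≤-<-trans U-q (≰⇒> ¬U-p) , refl
    where open Crossing c

  Early : Fin n → ℕ → Set
  Early p v = ∃ λ x → toℕ x ≤ toℕ p × val π x ≡ v

  Early? : ∀ p → Decidable (Early p)
  Early? p v = Fin.any? λ x → (toℕ x ≤? toℕ p) ×-dec (val π x ≟ v)

  record Switch (p q : Fin n) : Set where
    field
      value    : ℕ
      vq≤value : val π q ≤ value
      value<vp : value < val π p
      ¬early   : ¬ Early p value
      early    : Early p (suc value)

  open Switch

  switch : ∀ {p q} → Next p q → val π q < val π p → Switch p q
  switch {p} {q} next vq<vp with discrete-ivt (Early? p) (<⇒≤ vq<vp) ¬early-q (p , ≤-refl , refl)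
    where
    ¬early-q : ¬ Early p (val π q)
    ¬early-q (x , x≤p , vx≡vq) = <⇒≱ (next⇒< next) (subst (λ y → toℕ y ≤ toℕ p) (val-injective vx≡vq) x≤p)
  ... | i , vq≤i , i<vp , ¬early-i , early-1+i = record
    { value = i ; vq≤value = vq≤i ; value<vp = i<vp ; ¬early = ¬early-i ; early = early-1+i }

  1≤value : ∀ {p q} (s : Switch p q) → 1 ≤ value s
  1≤value s = ≤-trans (s≤s z≤n) (vq≤value s)

  value<n : ∀ {p q} (s : Switch p q) → value s < n
  value<n {p} s = <-≤-trans (value<vp s) (val≤n p)

  switch-after : ∀ {p q} (s : Switch p q) → ∃ λ a → val π a ≡ value s × toℕ p < toℕ a
  switch-after s with val-surjective (1≤value s) (<⇒≤ (value<n s))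
  ... | a , va = a , va , ≰⇒> λ a≤p → ¬early s (a , a≤p , va)

  switch-ides : ∀ {p q} (s : Switch p q) → IDES π (value s)
  switch-ides s with early s | switch-after s
  ... | b , b≤p , vb | a , va , p<a = 1≤value s , <⇒≤∸1 (value<n s) , a , b , va , vb , ≤-<-trans b≤p p<a

  module _ (baxter : IsBaxter π) where

    no-2-41-3 : ∀ {i j j' k} → toℕ i < toℕ j → Next j j' → toℕ j' < toℕ k →
      val π j' < val π i → val π i < val π k → val π k < val π j → ⊥
    no-2-41-3 i<j next j'<k lt₁ lt₂ lt₃ = baxter _ _ _ _ i<j next j'<k (inj₁ (lt₁ , lt₂ , lt₃))

    no-3-14-2 : ∀ {i j j' k} → toℕ i < toℕ j → Next j j' → toℕ j' < toℕ k →
      val π j < val π k → val π k < val π i → val π i < val π j' → ⊥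
    no-3-14-2 i<j next j'<k lt₁ lt₂ lt₃ = baxter _ _ _ _ i<j next j'<k (inj₂ (lt₁ , lt₂ , lt₃))

    no-common-descent : ∀ {m m' b p q a'} → m < m' → Next p q →
      val π b ≡ suc m → val π a' ≡ m' → toℕ b ≤ toℕ p → toℕ q ≤ toℕ a' →
      val π q ≤ m → m' < val π p → ⊥
    no-common-descent {m} {m'} {b} {p} {q} {a'} m<m' next vb va' b≤p q≤a' vq≤m m'<vp
      with m≤n⇒m<n∨m≡n m<m'
    ... | inj₂ refl =
      <-irrefl (cong toℕ (val-injective (trans vb (sym va')))) (≤-<-trans b≤p (<-≤-trans (next⇒< next) q≤a'))
    ... | inj₁ 1+m<m' = no-2-41-3 b<p next q<a' vq<vb vb<va' va'<vp
      where
      vq<vb : val π q < val π b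
      vq<vb = subst (val π q <_) (sym vb) (s≤s vq≤m)
      vb<va' : val π b < val π a'
      vb<va' = subst₂ _<_ (sym vb) (sym va') 1+m<m'
      va'<vp : val π a' < val π p
      va'<vp = subst (_< val π p) (sym va') m'<vp
      b<p : toℕ b < toℕ p
      b<p = ≤∧≢⇒< b≤p (val≢⇒toℕ≢ (<⇒≢ (<-trans vb<va' va'<vp)))
      q<a' : toℕ q < toℕ a'
      q<a' = ≤∧≢⇒< q≤a' (val≢⇒toℕ≢ (<⇒≢ (<-trans vq<vb vb<va')))

    no-common-inverse-descent : ∀ {i b p q p' a'} → toℕ p < toℕ p' → Next p q →
      val π b ≡ suc i → val π a' ≡ i → toℕ b ≤ toℕ p → toℕ p' < toℕ a' →
      val π q ≤ i → i < val π p' → ⊥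
    no-common-inverse-descent {i} {b} {p} {q} {p'} {a'} p<p' next vb va' b≤p p'<a' vq≤i i<vp' =
      no-3-14-2 b<J J↝J+1 J+1<a' vJ<va' va'<vb vb<vJ+1
      where
      ascent : Crossing (λ x → i < val π x) q p'
      ascent = crossing (λ x → i <? val π x) (subst (_≤ toℕ p') (sym next) p<p') (λ i<vq → <⇒≱ i<vq vq≤i) i<vp'
      open Crossing ascent renaming (p to J; q to J+1; next to J↝J+1)
      b<J : toℕ b < toℕ J
      b<J = ≤-<-trans b≤p (<-≤-trans (next⇒< next) lo≤p)
      J+1<a' : toℕ J+1 < toℕ a'
      J+1<a' = ≤-<-trans q≤hi p'<a'
      vJ<va' : val π J < val π a'
      vJ<va' = val≤∧≢⇒< (subst (val π J ≤_) (sym va') (≮⇒≥ ¬U-p)) (Fin.<⇒≢ (<-trans (next⇒< J↝J+1) J+1<a'))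
      va'<vb : val π a' < val π b
      va'<vb = subst₂ _<_ (sym va') (sym vb) (n<1+n i)
      vb<vJ+1 : val π b < val π J+1
      vb<vJ+1 = val≤∧≢⇒< (subst (_≤ val π J+1) (sym vb) U-q) (Fin.<⇒≢ (<-trans b<J (next⇒< J↝J+1)))

    ides↪db : ∀ t → DecreasingInjection (IDES π) (DB π) t
    ides↪db t = record
      { f           = val π ∘ Crossing.q ∘ descentᴵ
      ; f-pos       = λ _ _ → s≤s z≤n
      ; f-≤         = λ w _ → Crossing.U-q (descentᴵ w)
      ; f-into      = λ w _ → descent-below-DB (descentᴵ w)
      ; f-injective = injective
      }
      where
      open Crossing

      descentᴵ : ∀ {m} ((_ , _ , a , b , _) : IDES π m) → Crossing (Below m) b a
      descentᴵ (_ , _ , _ , _ , va , vb , b<a) = descent-below va vb b<a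

      distinct : ∀ {m m'} (w : IDES π m) (w' : IDES π m') → m < m' →
        val π (q (descentᴵ w)) ≢ val π (q (descentᴵ w'))
      distinct {m} {m'} w@(_ , _ , a , b , _ , vb , _) w'@(_ , _ , a' , b' , va' , _ , _) m<m' e =
        no-common-descent m<m' (next c) vb va' (lo≤p c) (subst (λ x → toℕ x ≤ toℕ a') (sym q≡q') (q≤hi c'))
          (U-q c) (subst (λ x → m' < val π x) (sym p≡p') (≰⇒> (¬U-p c')))
        where
        c : Crossing (Below m) b a
        c = descentᴵ w
        c' : Crossing (Below m') b' a'
        c' = descentᴵ w'
        q≡q' : q c ≡ q c'
        q≡q' = val-injective e
        p≡p' : p c ≡ p c'
        p≡p' = next-injective (next c) (subst (Next (p c')) (sym q≡q') (next c'))

      injective : ∀ {m m'} (w : IDES π m) (w' : IDES π m') → m ≤ t → m' ≤ t →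
        val π (q (descentᴵ w)) ≡ val π (q (descentᴵ w')) → m ≡ m'
      injective {m} {m'} w w' _ _ e with <-cmp m m'
      ... | tri< m<m' _ _ = contradiction e (distinct w w' m<m')
      ... | tri≈ _ m≡m' _ = m≡m'
      ... | tri> _ _ m'<m = contradiction (sym e) (distinct w' w m'<m)

    dt↪ides : ∀ t → DecreasingInjection (DTt π) (IDES π) t
    dt↪ides t = record
      { f           = value ∘ switchᴰ
      ; f-pos       = λ w _ → 1≤value (switchᴰ w)
      ; f-≤         = λ { w@(_ , _ , _ , _ , m≡vp∸1) _ → subst (_ ≤_) (sym m≡vp∸1) (<⇒≤∸1 (value<vp (switchᴰ w))) }
      ; f-into      = λ w _ → switch-ides (switchᴰ w)
      ; f-injective = injective
      }
      where
      switchᴰ : ∀ {m} ((p , q , _) : DTt π m) → Switch p q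
      switchᴰ (_ , _ , next , vq<vp , _) = switch next vq<vp

      distinct : ∀ {p q p' q'} (s : Switch p q) (s' : Switch p' q') → Next p q →
        toℕ p < toℕ p' → value s ≢ value s'
      distinct s s' next p<p' refl with early s | switch-after s'
      ... | b , b≤p , vb | a' , va' , p'<a' =
        no-common-inverse-descent p<p' next vb va' b≤p p'<a' (vq≤value s) (value<vp s')

      injective : ∀ {m m'} (w : DTt π m) (w' : DTt π m') → m ≤ t → m' ≤ t →
        value (switchᴰ w) ≡ value (switchᴰ w') → m ≡ m'
      injective w@(p , _ , next , _ , m≡) w'@(p' , _ , next' , _ , m'≡) _ _ e with Fin.<-cmp p p'
      ... | tri< p<p' _ _ = contradiction e (distinct (switchᴰ w) (switchᴰ w') next p<p')
      ... | tri≈ _ refl _ = trans m≡ (sym m'≡)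
      ... | tri> _ _ p'<p = contradiction (sym e) (distinct (switchᴰ w') (switchᴰ w) next' p'<p)

lemma2p3 : (n : ℕ) (π : Perm n) → IsBaxter π →
    (bot mid top : ℕ → Point) →
    IsPath (n ∸ 1) (2 , 0) (DB π) bot →
    IsPath (n ∸ 1) (1 , 1) (IDES π) mid →
    IsPath (n ∸ 1) (0 , 2) (DTt π) top →
    Disjoint (n ∸ 1) bot mid × Disjoint (n ∸ 1) bot top × Disjoint (n ∸ 1) mid top
lemma2p3 n π baxter bot mid top bot-path mid-path top-path =
  disjoint-if-strictly-right (DB? π) (IDES? π) bot-path mid-path refl (λ t _ → s≤s (s≤s (ides≤db t))) ,
  disjoint-if-strictly-right (DB? π) (DTt? π) bot-path top-path refl
    (λ t _ → s≤s (m≤n⇒m≤1+n (≤-trans (dt≤ides t) (ides≤db t)))) ,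
  disjoint-if-strictly-right (IDES? π) (DTt? π) mid-path top-path refl (λ t _ → s≤s (dt≤ides t))
  where
  ides≤db : ∀ t → count (IDES? π) t ≤ count (DB? π) t
  ides≤db t = count-mono (IDES? π) (DB? π) t (ides↪db π baxter t)
  dt≤ides : ∀ t → count (DTt? π) t ≤ count (IDES? π) t
  dt≤ides t = count-mono (DTt? π) (IDES? π) t (dt↪ides π baxter t)
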